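{- For every integer $n\geq 1$ the following identities hold in $\mathbb{Q}[t]$: \begin{align*} \binom{2n}{n}\sum_{k=1}^n \frac{t^{k-1}}{k\binom{2k}{k}} &= \sum_{k=1}^{n} \binom{2n}{n-k}\frac{u_{k}(t-2)}{k},\\ \binom{2n}{n}\sum_{k=1}^n \frac{t^k}{k^2\binom{2k}{k}} &= \sum_{k=1}^{n} \binom{2n}{n-k}\frac{v_{k}(t-2)}{k^2}+\binom{2n}{n}\sum_{k=1}^n \frac{1}{k^2},\\ \binom{2n}{n}\sum_{k=1}^n \frac{t^k}{k^3\binom{2k}{k}} &= \sum_{k=1}^{n} \binom{2n}{n-k}\frac{v_{k}(t-2)}{k^3} +2\sum_{1\leq j<k\leq n}\binom{2n}{n-k}\frac{(-1)^{k-j}\,v_{j}(t-2)}{jk^2} +\binom{2n}{n}\sum_{k=1}^n \frac{1}{k^3}. \end{align*}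
   Context: The Lucas polynomials $u_n(x),v_n(x)\in\mathbb{Z}[x]$ are defined by $u_0=0$, $u_1=1$, $u_n(x)=x\,u_{n-1}(x)-u_{n-2}(x)$ for $n>1$, and $v_0=2$, $v_1=x$, $v_n(x)=x\,v_{n-1}(x)-v_{n-2}(x)$ for $n>1$. -}

module Defs where

open import Data.Nat as ℕ using (ℕ; zero; suc; _∸_)
open import Data.Nat.Combinatorics using (_C_)
open import Data.Integer using (+_)
open import Data.Rational using (ℚ; 0ℚ; 1ℚ; _+_; _*_; _-_; -_; _/_)

ofℕ : ℕ → ℚ
ofℕ n = + n / 1

-- 1/d for a positive natural d (junk value 0 at d = 0, never used below
-- since every denominator occurring is provably positive)
inv : ℕ → ℚ
inv zero    = 0ℚ
inv (suc d) = + 1 / suc d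

_^_ : ℚ → ℕ → ℚ
x ^ zero  = 1ℚ
x ^ suc m = x * (x ^ m)

sgn : ℕ → ℚ
sgn zero    = 1ℚ
sgn (suc m) = - sgn m

u : ℕ → ℚ → ℚ
u zero x = 0ℚ
u (suc zero) x = 1ℚ
u (suc (suc n)) x = x * u (suc n) x - u n x

v : ℕ → ℚ → ℚ
v zero x = ofℕ 2
v (suc zero) x = x
v (suc (suc n)) x = x * v (suc n) x - v n x

Σ₁ : ℕ → (ℕ → ℚ) → ℚ
Σ₁ zero    f = 0ℚ
Σ₁ (suc n) f = Σ₁ n f + f (suc n)

binom : ℕ → ℕ → ℚ
binom m k = ofℕ (m C k)

cb : ℕ → ℕ
cb k = (2 ℕ.* k) C k

lhs1 rhs1 lhs2 rhs2 lhs3 rhs3 : ℕ → ℚ → ℚ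
lhs1 n t = binom (2 ℕ.* n) n * Σ₁ n (λ k → (t ^ (k ∸ 1)) * inv (k ℕ.* cb k))
rhs1 n t = Σ₁ n (λ k → binom (2 ℕ.* n) (n ∸ k) * u k (t - ofℕ 2) * inv k)
lhs2 n t = binom (2 ℕ.* n) n * Σ₁ n (λ k → (t ^ k) * inv (k ℕ.* k ℕ.* cb k))
rhs2 n t = Σ₁ n (λ k → binom (2 ℕ.* n) (n ∸ k) * v k (t - ofℕ 2) * inv (k ℕ.* k))
         + binom (2 ℕ.* n) n * Σ₁ n (λ k → inv (k ℕ.* k))
lhs3 n t = binom (2 ℕ.* n) n * Σ₁ n (λ k → (t ^ k) * inv (k ℕ.* k ℕ.* k ℕ.* cb k))
rhs3 n t = Σ₁ n (λ k → binom (2 ℕ.* n) (n ∸ k) * v k (t - ofℕ 2) * inv (k ℕ.* k ℕ.* k))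
         + ofℕ 2 * Σ₁ n (λ k → Σ₁ (k ∸ 1) (λ j →
              binom (2 ℕ.* n) (n ∸ k) * sgn (k ∸ j) * v j (t - ofℕ 2) * inv (j ℕ.* k ℕ.* k)))
         + binom (2 ℕ.* n) n * Σ₁ n (λ k → inv (k ℕ.* k ℕ.* k))

-- Both sides of each identity satisfy the same recurrence X(n+1) = ρₙ X(n) + δₙ, X(0) = 0,
-- with ρₙ = C(2n+2,n+1)/C(2n,n) = 2(2n+1)/(n+1).
-- On the right, ((n+1)² - k²) C(2n+2,n+1-k) = 2(n+1)(2n+1) C(2n,n-k) splits each term into ρₙ
-- times the corresponding term of row n plus C(2n+2,n+1-k) f(k)/(n+1)², and the binomial sums
-- left over are evaluated by the row identities Σₖ C(2n,n-k) vₖ(t-2) + C(2n,n) = tⁿ and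
-- Σₖ C(2n+1,n+1-k) (uₖ - uₖ₋₁)(t-2) = tⁿ: writing t - 2 = x + x⁻¹, these are the binomial
-- expansion of tⁿ = (x^½ + x^-½)²ⁿ.  In the third identity the double sum enters through
-- gₖ = vₖ/k + 2 Σ_{j<k} (-1)^(k-j) vⱼ/j, and gₖ + gₖ₊₁ = vₖ₊₁/(k+1) - vₖ/k telescopes.

module Submission where

open import Defs
open import Data.Nat as ℕ using (ℕ; zero; suc; _∸_; _≤_; _<_; z≤n; s≤s)
import Data.Nat.Properties as ℕ
open import Data.Nat.Combinatorics using (_C_; nCk+nC[k+1]≡[n+1]C[k+1]; nCk≡nC[n∸k]; nC1≡n)
import Data.Nat.Coprimality as Coprimality
import Data.Nat.Tactic.RingSolver as ℕ-Solver
import Data.Integer as ℤ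
import Data.Integer.Properties as ℤ
import Data.Integer.Tactic.RingSolver as ℤ-Solver
open import Data.Rational using (ℚ; mkℚ; 0ℚ; 1ℚ; _+_; _*_; _-_; -_; _≟_; toℚᵘ)
open import Data.Rational.Properties
  using ( +-*-commutativeRing; normalize-coprime; toℚᵘ-injective; toℚᵘ-homo-+; toℚᵘ-homo-*
        ; *-inverseʳ; +-assoc; +-comm; *-distribˡ-+; *-distribʳ-+; *-identityˡ; *-identityʳ; *-assoc; *-comm; *-zeroʳ)
import Data.Rational.Unnormalised as ℚᵘ
import Data.Rational.Unnormalised.Properties as ℚᵘ
open import Data.Product using (_×_; _,_)
open import Data.List using (_∷_; [])
open import Level using (0ℓ)
open import Relation.Nullary.Decidable using (dec⇒maybe)
open import Relation.Binary.PropositionalEquality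
open import Tactic.RingSolver using (solve-∀; solve)
open import Tactic.RingSolver.Core.AlmostCommutativeRing using (AlmostCommutativeRing; fromCommutativeRing)

ℚ-ring : AlmostCommutativeRing 0ℓ 0ℓ
ℚ-ring = fromCommutativeRing +-*-commutativeRing λ x → dec⇒maybe (0ℚ ≟ x)

toℚᵘ-ofℕ : ∀ n → toℚᵘ (ofℕ n) ≡ ℚᵘ.mkℚᵘ (ℤ.+ n) 0
toℚᵘ-ofℕ n = cong toℚᵘ (normalize-coprime (Coprimality.sym (Coprimality.1-coprimeTo n)))

ofℕ-+ : ∀ m n → ofℕ (m ℕ.+ n) ≡ ofℕ m + ofℕ n
ofℕ-+ m n = toℚᵘ-injective (begin
  toℚᵘ (ofℕ (m ℕ.+ n))                          ≡⟨ toℚᵘ-ofℕ (m ℕ.+ n) ⟩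
  ℚᵘ.mkℚᵘ (ℤ.+ (m ℕ.+ n)) 0                      ≈⟨ ℚᵘ.*≡* (cong (ℤ._* ℤ.+ 1) (trans (ℤ.pos-+ m n) (units (ℤ.+ m) (ℤ.+ n)))) ⟩
  ℚᵘ.mkℚᵘ (ℤ.+ m) 0 ℚᵘ.+ ℚᵘ.mkℚᵘ (ℤ.+ n) 0      ≡⟨ cong₂ ℚᵘ._+_ (toℚᵘ-ofℕ m) (toℚᵘ-ofℕ n) ⟨
  toℚᵘ (ofℕ m) ℚᵘ.+ toℚᵘ (ofℕ n)                 ≈⟨ toℚᵘ-homo-+ (ofℕ m) (ofℕ n) ⟨
  toℚᵘ (ofℕ m + ofℕ n)                           ∎)
  where
  open ℚᵘ.≃-Reasoning
  units : ∀ a b → a ℤ.+ b ≡ a ℤ.* ℤ.+ 1 ℤ.+ b ℤ.* ℤ.+ 1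
  units = ℤ-Solver.solve-∀

ofℕ-* : ∀ m n → ofℕ (m ℕ.* n) ≡ ofℕ m * ofℕ n
ofℕ-* m n = toℚᵘ-injective (begin
  toℚᵘ (ofℕ (m ℕ.* n))                          ≡⟨ toℚᵘ-ofℕ (m ℕ.* n) ⟩
  ℚᵘ.mkℚᵘ (ℤ.+ (m ℕ.* n)) 0                      ≈⟨ ℚᵘ.*≡* (cong (ℤ._* ℤ.+ 1) (ℤ.pos-* m n)) ⟩
  ℚᵘ.mkℚᵘ (ℤ.+ m) 0 ℚᵘ.* ℚᵘ.mkℚᵘ (ℤ.+ n) 0      ≡⟨ cong₂ ℚᵘ._*_ (toℚᵘ-ofℕ m) (toℚᵘ-ofℕ n) ⟨
  toℚᵘ (ofℕ m) ℚᵘ.* toℚᵘ (ofℕ n)                 ≈⟨ toℚᵘ-homo-* (ofℕ m) (ofℕ n) ⟨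
  toℚᵘ (ofℕ m * ofℕ n)                           ∎)
  where open ℚᵘ.≃-Reasoning

-- ofℕ (suc d) and inv (suc d) normalise to mkℚ (+ suc d) 0 and mkℚ (+ 1) d; the latter is 1/ the former.
ofℕ*inv≡1 : ∀ d → ofℕ (suc d) * inv (suc d) ≡ 1ℚ
ofℕ*inv≡1 d = trans
  (cong₂ _*_ (normalize-coprime (Coprimality.sym (Coprimality.1-coprimeTo (suc d))))
             (normalize-coprime (Coprimality.1-coprimeTo (suc d))))
  (*-inverseʳ (mkℚ (ℤ.+ suc d) 0 (Coprimality.sym (Coprimality.1-coprimeTo (suc d)))))

ofℕ*x≡y⇒x≡inv*y : ∀ d {x y} → ofℕ (suc d) * x ≡ y → x ≡ inv (suc d) * y
ofℕ*x≡y⇒x≡inv*y d {x} {y} dx≡y = begin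
  x                                   ≡⟨ *-identityˡ x ⟨
  1ℚ * x                              ≡⟨ cong (_* x) (trans (*-comm (inv (suc d)) (ofℕ (suc d))) (ofℕ*inv≡1 d)) ⟨
  (inv (suc d) * ofℕ (suc d)) * x     ≡⟨ *-assoc (inv (suc d)) (ofℕ (suc d)) x ⟩
  inv (suc d) * (ofℕ (suc d) * x)     ≡⟨ cong (inv (suc d) *_) dx≡y ⟩
  inv (suc d) * y                     ∎
  where open ≡-Reasoning

inv-* : ∀ a b → inv (suc a ℕ.* suc b) ≡ inv (suc a) * inv (suc b)
inv-* a b = sym (trans (ofℕ*x≡y⇒x≡inv*y (b ℕ.+ a ℕ.* suc b) (begin
  ofℕ (suc a ℕ.* suc b) * (inv (suc a) * inv (suc b))
    ≡⟨ cong (_* (inv (suc a) * inv (suc b))) (ofℕ-* (suc a) (suc b)) ⟩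
  (ofℕ (suc a) * ofℕ (suc b)) * (inv (suc a) * inv (suc b))
    ≡⟨ interchange (ofℕ (suc a)) (ofℕ (suc b)) (inv (suc a)) (inv (suc b)) ⟩
  (ofℕ (suc a) * inv (suc a)) * (ofℕ (suc b) * inv (suc b))
    ≡⟨ cong₂ _*_ (ofℕ*inv≡1 a) (ofℕ*inv≡1 b) ⟩
  1ℚ * 1ℚ
    ≡⟨⟩
  1ℚ ∎)) (*-identityʳ _))
  where
  open ≡-Reasoning
  interchange : ∀ x y z w → (x * y) * (z * w) ≡ (x * z) * (y * w)
  interchange = solve-∀ ℚ-ring

ofℕ*[x*inv]≡x : ∀ k x → ofℕ (suc k) * (x * inv (suc k)) ≡ x
ofℕ*[x*inv]≡x k x = begin
  ofℕ (suc k) * (x * inv (suc k))    ≡⟨ reorder (ofℕ (suc k)) x (inv (suc k)) ⟩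
  (ofℕ (suc k) * inv (suc k)) * x    ≡⟨ cong (_* x) (ofℕ*inv≡1 k) ⟩
  1ℚ * x                             ≡⟨ *-identityˡ x ⟩
  x                                  ∎
  where
  open ≡-Reasoning
  reorder : ∀ K x i → K * (x * i) ≡ (K * i) * x
  reorder = solve-∀ ℚ-ring

ofℕ[c]*inv[d*c]≡inv[d] : ∀ {d c} → 0 < d → 0 < c → ofℕ c * inv (d ℕ.* c) ≡ inv d
ofℕ[c]*inv[d*c]≡inv[d] {suc a} {suc m} _ _ =
  trans (cong (ofℕ (suc m) *_) (inv-* a m)) (ofℕ*[x*inv]≡x m (inv (suc a)))

Σ₁-cong : ∀ n {f g : ℕ → ℚ} → (∀ k → k < n → f (suc k) ≡ g (suc k)) → Σ₁ n f ≡ Σ₁ n g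
Σ₁-cong zero    f≗g = refl
Σ₁-cong (suc n) f≗g = cong₂ _+_ (Σ₁-cong n (λ k k<n → f≗g k (ℕ.m<n⇒m<1+n k<n))) (f≗g n ℕ.≤-refl)

Σ₁-linear : ∀ n a b {f g h : ℕ → ℚ} → (∀ k → k < n → f (suc k) ≡ a * g (suc k) + b * h (suc k)) →
            Σ₁ n f ≡ a * Σ₁ n g + b * Σ₁ n h
Σ₁-linear zero    a b f≗ag+bh = solve (a ∷ b ∷ []) ℚ-ring
Σ₁-linear (suc n) a b {f} {g} {h} f≗ag+bh = begin
  Σ₁ n f + f (suc n)
    ≡⟨ cong₂ _+_ (Σ₁-linear n a b (λ k k<n → f≗ag+bh k (ℕ.m<n⇒m<1+n k<n))) (f≗ag+bh n ℕ.≤-refl) ⟩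
  (a * Σ₁ n g + b * Σ₁ n h) + (a * g (suc n) + b * h (suc n))
    ≡⟨ regroup a b (Σ₁ n g) (Σ₁ n h) (g (suc n)) (h (suc n)) ⟩
  a * (Σ₁ n g + g (suc n)) + b * (Σ₁ n h + h (suc n)) ∎
  where
  open ≡-Reasoning
  regroup : ∀ a b x y x′ y′ → (a * x + b * y) + (a * x′ + b * y′) ≡ a * (x + x′) + b * (y + y′)
  regroup = solve-∀ ℚ-ring

Σ₁-+ : ∀ n (f g : ℕ → ℚ) → Σ₁ n f + Σ₁ n g ≡ Σ₁ n (λ k → f k + g k)
Σ₁-+ n f g = sym (trans (Σ₁-linear n 1ℚ 1ℚ (λ k _ → sym (units (f (suc k)) (g (suc k))))) (units (Σ₁ n f) (Σ₁ n g)))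
  where
  units : ∀ x y → 1ℚ * x + 1ℚ * y ≡ x + y
  units = solve-∀ ℚ-ring

Σ₁-*ˡ : ∀ n a (f : ℕ → ℚ) → a * Σ₁ n f ≡ Σ₁ n (λ k → a * f k)
Σ₁-*ˡ zero    a f = *-zeroʳ a
Σ₁-*ˡ (suc n) a f = trans (*-distribˡ-+ a (Σ₁ n f) (f (suc n))) (cong (_+ a * f (suc n)) (Σ₁-*ˡ n a f))

Σ₁-peelˡ : ∀ n (f : ℕ → ℚ) → Σ₁ (suc n) f ≡ f 1 + Σ₁ n (λ k → f (suc k))
Σ₁-peelˡ zero    f = +-comm 0ℚ (f 1)
Σ₁-peelˡ (suc n) f = trans (cong (_+ f (suc (suc n))) (Σ₁-peelˡ n f)) (+-assoc (f 1) _ _)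

same-recurrence⇒≡ : ∀ (r d : ℕ → ℚ) {f g : ℕ → ℚ} → f 0 ≡ g 0 →
                    (∀ n → f (suc n) ≡ r n * f n + d n) → (∀ n → g (suc n) ≡ r n * g n + d n) →
                    ∀ n → f n ≡ g n
same-recurrence⇒≡ r d f₀≡g₀ recf recg zero    = f₀≡g₀
same-recurrence⇒≡ r d f₀≡g₀ recf recg (suc n) =
  trans (recf n) (trans (cong (λ x → r n * x + d n) (same-recurrence⇒≡ r d f₀≡g₀ recf recg n)) (sym (recg n)))

C-pos : ∀ {n k} → k ≤ n → 0 < n C k
C-pos {n}     {zero}  _         = s≤s z≤n
C-pos {suc n} {suc k} (s≤s k≤n) =
  subst (0 <_) (nCk+nC[k+1]≡[n+1]C[k+1] n k) (ℕ.≤-trans (C-pos k≤n) (ℕ.m≤m+n (n C k) (n C suc k)))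

C-absorb : ∀ n k → suc k ℕ.* (suc n C suc k) ≡ suc n ℕ.* (n C k)
C-absorb n zero = trans (ℕ.*-identityˡ (suc n C 1)) (trans (nC1≡n (suc n)) (sym (ℕ.*-identityʳ (suc n))))
C-absorb zero (suc k) =
  trans (cong (suc (suc k) ℕ.*_) (sym (nCk+nC[k+1]≡[n+1]C[k+1] 0 (suc k)))) (ℕ.*-zeroʳ (suc (suc k)))
C-absorb (suc n) (suc k) = begin
  suc (suc k) ℕ.* (suc (suc n) C suc (suc k))
    ≡⟨ cong (suc (suc k) ℕ.*_) (pascal (suc n) (suc k)) ⟨
  suc (suc k) ℕ.* (suc n C suc k ℕ.+ suc n C suc (suc k))
    ≡⟨ expand k (suc n C suc k) (suc n C suc (suc k)) ⟩
  (suc k ℕ.* (suc n C suc k) ℕ.+ suc n C suc k) ℕ.+ suc (suc k) ℕ.* (suc n C suc (suc k))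
    ≡⟨ cong₂ (λ x y → (x ℕ.+ suc n C suc k) ℕ.+ y) (C-absorb n k) (C-absorb n (suc k)) ⟩
  (suc n ℕ.* (n C k) ℕ.+ suc n C suc k) ℕ.+ suc n ℕ.* (n C suc k)
    ≡⟨ cong (λ x → (suc n ℕ.* (n C k) ℕ.+ x) ℕ.+ suc n ℕ.* (n C suc k)) (pascal n k) ⟨
  (suc n ℕ.* (n C k) ℕ.+ (n C k ℕ.+ n C suc k)) ℕ.+ suc n ℕ.* (n C suc k)
    ≡⟨ collect n (n C k) (n C suc k) ⟩
  suc (suc n) ℕ.* (n C k ℕ.+ n C suc k)
    ≡⟨ cong (suc (suc n) ℕ.*_) (pascal n k) ⟩
  suc (suc n) ℕ.* (suc n C suc k) ∎
  where
  open ≡-Reasoning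
  pascal = nCk+nC[k+1]≡[n+1]C[k+1]
  expand : ∀ k x y → suc (suc k) ℕ.* (x ℕ.+ y) ≡ (suc k ℕ.* x ℕ.+ x) ℕ.+ suc (suc k) ℕ.* y
  expand = ℕ-Solver.solve-∀
  collect : ∀ n x y → (suc n ℕ.* x ℕ.+ (x ℕ.+ y)) ℕ.+ suc n ℕ.* y ≡ suc (suc n) ℕ.* (x ℕ.+ y)
  collect = ℕ-Solver.solve-∀

C-sym : ∀ i j → (i ℕ.+ j) C i ≡ (i ℕ.+ j) C j
C-sym i j = trans (nCk≡nC[n∸k] (ℕ.m≤m+n i j)) (cong ((i ℕ.+ j) C_) (ℕ.m+n∸m≡n i j))

C-absorb-complement : ∀ i j → suc j ℕ.* (suc (i ℕ.+ j) C i) ≡ suc (i ℕ.+ j) ℕ.* ((i ℕ.+ j) C i)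
C-absorb-complement i j = begin
  suc j ℕ.* (suc (i ℕ.+ j) C i)       ≡⟨ cong (λ m → suc j ℕ.* (m C i)) (ℕ.+-suc i j) ⟨
  suc j ℕ.* ((i ℕ.+ suc j) C i)       ≡⟨ cong (suc j ℕ.*_) (C-sym i (suc j)) ⟩
  suc j ℕ.* ((i ℕ.+ suc j) C suc j)   ≡⟨ cong (λ m → suc j ℕ.* (m C suc j)) (ℕ.+-suc i j) ⟩
  suc j ℕ.* (suc (i ℕ.+ j) C suc j)   ≡⟨ C-absorb (i ℕ.+ j) j ⟩
  suc (i ℕ.+ j) ℕ.* ((i ℕ.+ j) C j)   ≡⟨ cong (suc (i ℕ.+ j) ℕ.*_) (C-sym i j) ⟨
  suc (i ℕ.+ j) ℕ.* ((i ℕ.+ j) C i)   ∎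
  where open ≡-Reasoning

ofℕ-*-cong : ∀ {a b c d} → a ℕ.* b ≡ c ℕ.* d → ofℕ a * ofℕ b ≡ ofℕ c * ofℕ d
ofℕ-*-cong {a} {b} {c} {d} eq = trans (sym (ofℕ-* a b)) (trans (cong ofℕ eq) (ofℕ-* c d))

binom-pascal : ∀ m k → binom (suc m) (suc k) ≡ binom m k + binom m (suc k)
binom-pascal m k = trans (cong ofℕ (sym (nCk+nC[k+1]≡[n+1]C[k+1] m k))) (ofℕ-+ (m C k) (m C suc k))

binom-absorb : ∀ n k → ofℕ (suc k) * binom (suc n) (suc k) ≡ ofℕ (suc n) * binom n k
binom-absorb n k = ofℕ-*-cong {suc k} {suc n C suc k} {suc n} {n C k} (C-absorb n k)

binom-absorb-complement : ∀ i j →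
  ofℕ (suc j) * binom (suc (i ℕ.+ j)) i ≡ ofℕ (suc (i ℕ.+ j)) * binom (i ℕ.+ j) i
binom-absorb-complement i j =
  ofℕ-*-cong {suc j} {suc (i ℕ.+ j) C i} {suc (i ℕ.+ j)} {(i ℕ.+ j) C i} (C-absorb-complement i j)

2[1+n]≡2+2n : ∀ n → 2 ℕ.* suc n ≡ suc (suc (2 ℕ.* n))
2[1+n]≡2+2n = ℕ-Solver.solve-∀

binom-central-pascal : ∀ n → binom (2 ℕ.* suc n) (suc n) ≡ ofℕ 2 * binom (suc (2 ℕ.* n)) n
binom-central-pascal n = begin
  binom (2 ℕ.* suc n) (suc n)          ≡⟨ cong (λ m → binom m (suc n)) (2[1+n]≡2+2n n) ⟩
  binom (suc (suc (2 ℕ.* n))) (suc n)  ≡⟨ binom-pascal (suc (2 ℕ.* n)) n ⟩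
  e n + e (suc n)                      ≡⟨ cong (λ x → e n + x) central-sym ⟨
  e n + e n                            ≡⟨ double (e n) ⟩
  ofℕ 2 * e n                          ∎
  where
  open ≡-Reasoning
  e = binom (suc (2 ℕ.* n))
  central-sym : e n ≡ e (suc n)
  central-sym = subst (λ m → binom m n ≡ binom m (suc n)) (n+[1+n]≡1+2n n) (cong ofℕ (C-sym n (suc n)))
    where
    n+[1+n]≡1+2n : ∀ n → n ℕ.+ suc n ≡ suc (2 ℕ.* n)
    n+[1+n]≡1+2n = ℕ-Solver.solve-∀
  double : ∀ x → x + x ≡ ofℕ 2 * x
  double = solve-∀ ℚ-ring

ρ : ℕ → ℚ
ρ n = ofℕ 2 * ofℕ (suc (2 ℕ.* n)) * inv (suc n)

binom-central-suc : ∀ n → binom (2 ℕ.* suc n) (suc n) ≡ ρ n * binom (2 ℕ.* n) n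
binom-central-suc n = begin
  binom (2 ℕ.* suc n) (suc n)                                       ≡⟨ binom-central-pascal n ⟩
  ofℕ 2 * binom (suc (2 ℕ.* n)) n                                   ≡⟨ cong (ofℕ 2 *_) (ofℕ*x≡y⇒x≡inv*y n absorb) ⟩
  ofℕ 2 * (inv (suc n) * (ofℕ (suc (2 ℕ.* n)) * binom (2 ℕ.* n) n)) ≡⟨ reassoc (ofℕ (suc (2 ℕ.* n))) (inv (suc n)) _ ⟩
  ρ n * binom (2 ℕ.* n) n                                           ∎
  where
  open ≡-Reasoning
  n+n≡2n : ∀ n → n ℕ.+ n ≡ 2 ℕ.* n
  n+n≡2n = ℕ-Solver.solve-∀
  absorb : ofℕ (suc n) * binom (suc (2 ℕ.* n)) n ≡ ofℕ (suc (2 ℕ.* n)) * binom (2 ℕ.* n) n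
  absorb = subst (λ m → ofℕ (suc n) * binom (suc m) n ≡ ofℕ (suc m) * binom m n)
                 (n+n≡2n n) (binom-absorb-complement n n)
  reassoc : ∀ M i c → ofℕ 2 * (i * (M * c)) ≡ ofℕ 2 * M * i * c
  reassoc = solve-∀ ℚ-ring

-- In the applications n = i + k + 1, I, K, N = i+1, k+1, n+1, M = 2n+1, iN and iK are the inverses
-- of N and K, and B′, B, e₀, e₁ = C(2n+2,i+1), C(2n,i), C(2n+1,i), C(2n+1,i+1).
binom-diff-ratio : ∀ {I K N iN B′ e₀ e₁ : ℚ} → N ≡ I + K → N * iN ≡ 1ℚ →
                   B′ ≡ e₀ + e₁ → I * B′ ≡ (N + N) * e₀ → e₁ - e₀ ≡ iN * (K * B′)
binom-diff-ratio {I} {K} {_} {iN} {_} {e₀} {e₁} refl NiN≡1 refl absorb = sym (begin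
  iN * (K * (e₀ + e₁))
    ≡⟨ solve (I ∷ K ∷ iN ∷ e₀ ∷ e₁ ∷ []) ℚ-ring ⟩
  iN * ((I + K) * (e₁ - e₀)) + iN * (((I + K) + (I + K)) * e₀ - I * (e₀ + e₁))
    ≡⟨ cong (λ x → iN * ((I + K) * (e₁ - e₀)) + iN * (x - I * (e₀ + e₁))) absorb ⟨
  iN * ((I + K) * (e₁ - e₀)) + iN * (I * (e₀ + e₁) - I * (e₀ + e₁))
    ≡⟨ solve (I ∷ K ∷ iN ∷ e₀ ∷ e₁ ∷ []) ℚ-ring ⟩
  ((I + K) * iN) * (e₁ - e₀)
    ≡⟨ cong (_* (e₁ - e₀)) NiN≡1 ⟩
  1ℚ * (e₁ - e₀)
    ≡⟨ *-identityˡ (e₁ - e₀) ⟩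
  e₁ - e₀ ∎)
  where open ≡-Reasoning

binom-sq-ratio : ∀ {I K N M iN iK B B′ e₀ : ℚ} → N ≡ I + K → N * iN ≡ 1ℚ → K * iK ≡ 1ℚ →
                 I * B′ ≡ (N + N) * e₀ → (N + K) * e₀ ≡ M * B →
                 B′ * (iK * iK) ≡ (ofℕ 2 * M * iN) * (B * (iK * iK)) + (iN * iN) * B′
binom-sq-ratio {I} {K} {_} {M} {iN} {iK} {B} {B′} {e₀} refl NiN≡1 KiK≡1 absorb complement = sym (begin
  (ofℕ 2 * M * iN) * (B * (iK * iK)) + (iN * iN) * B′
    ≡⟨ solve (M ∷ iN ∷ iK ∷ B ∷ B′ ∷ []) ℚ-ring ⟩
  1ℚ * (ofℕ 2 * M * iN * B * iK * iK) + iN * iN * B′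
    ≡⟨ cong (λ x → x * (ofℕ 2 * M * iN * B * iK * iK) + iN * iN * B′) NiN≡1 ⟨
  ((I + K) * iN) * (ofℕ 2 * M * iN * B * iK * iK) + iN * iN * B′
    ≡⟨ solve (I ∷ K ∷ M ∷ iN ∷ iK ∷ B ∷ B′ ∷ []) ℚ-ring ⟩
  (iN * iN * iK * iK) * (((I + K) + (I + K)) * (M * B)) + iN * iN * B′
    ≡⟨ cong (λ x → (iN * iN * iK * iK) * (((I + K) + (I + K)) * x) + iN * iN * B′) complement ⟨
  (iN * iN * iK * iK) * (((I + K) + (I + K)) * (((I + K) + K) * e₀)) + iN * iN * B′
    ≡⟨ solve (I ∷ K ∷ iN ∷ iK ∷ B′ ∷ e₀ ∷ []) ℚ-ring ⟩
  (iN * iN * iK * iK) * (((I + K) + K) * (((I + K) + (I + K)) * e₀)) + iN * iN * B′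
    ≡⟨ cong (λ x → (iN * iN * iK * iK) * (((I + K) + K) * x) + iN * iN * B′) absorb ⟨
  (iN * iN * iK * iK) * (((I + K) + K) * (I * B′)) + iN * iN * B′
    ≡⟨ solve (I ∷ K ∷ iN ∷ iK ∷ B′ ∷ []) ℚ-ring ⟩
  ((I + K) * iN) * ((I + K) * iN) * (iK * iK * B′) - (K * iK) * (K * iK) * (iN * iN * B′) + iN * iN * B′
    ≡⟨ cong₂ (λ x y → x * x * (iK * iK * B′) - y * y * (iN * iN * B′) + iN * iN * B′) NiN≡1 KiK≡1 ⟩
  1ℚ * 1ℚ * (iK * iK * B′) - 1ℚ * 1ℚ * (iN * iN * B′) + iN * iN * B′
    ≡⟨ solve (iN ∷ iK ∷ B′ ∷ []) ℚ-ring ⟩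
  B′ * (iK * iK) ∎)
  where open ≡-Reasoning

module _ (i k : ℕ) where
  private
    n = i ℕ.+ suc k
    e = binom (suc (2 ℕ.* n))

    pascal : binom (2 ℕ.* suc n) (suc i) ≡ e i + e (suc i)
    pascal = trans (cong (λ m → binom m (suc i)) (2[1+n]≡2+2n n)) (binom-pascal (suc (2 ℕ.* n)) i)

    absorb : ofℕ (suc i) * binom (2 ℕ.* suc n) (suc i) ≡ (ofℕ (suc n) + ofℕ (suc n)) * e i
    absorb = begin
      ofℕ (suc i) * binom (2 ℕ.* suc n) (suc i)          ≡⟨ cong (λ m → ofℕ (suc i) * binom m (suc i)) (2[1+n]≡2+2n n) ⟩
      ofℕ (suc i) * binom (suc (suc (2 ℕ.* n))) (suc i)  ≡⟨ binom-absorb (suc (2 ℕ.* n)) i ⟩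
      ofℕ (suc (suc (2 ℕ.* n))) * e i                    ≡⟨ cong (λ m → ofℕ m * e i) (2+2n≡[1+n]+[1+n] n) ⟩
      ofℕ (suc n ℕ.+ suc n) * e i                        ≡⟨ cong (_* e i) (ofℕ-+ (suc n) (suc n)) ⟩
      (ofℕ (suc n) + ofℕ (suc n)) * e i                  ∎
      where
      open ≡-Reasoning
      2+2n≡[1+n]+[1+n] : ∀ n → suc (suc (2 ℕ.* n)) ≡ suc n ℕ.+ suc n
      2+2n≡[1+n]+[1+n] = ℕ-Solver.solve-∀

    complement : (ofℕ (suc n) + ofℕ (suc k)) * e i ≡ ofℕ (suc (2 ℕ.* n)) * binom (2 ℕ.* n) i
    complement = trans (cong (_* e i) (sym (ofℕ-+ (suc n) (suc k))))
      (subst (λ m → ofℕ (suc (n ℕ.+ suc k)) * binom (suc m) i ≡ ofℕ (suc m) * binom m i)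
             (i+[n+1+k]≡2n i k) (binom-absorb-complement i (n ℕ.+ suc k)))
      where
      i+[n+1+k]≡2n : ∀ i k → i ℕ.+ ((i ℕ.+ suc k) ℕ.+ suc k) ≡ 2 ℕ.* (i ℕ.+ suc k)
      i+[n+1+k]≡2n = ℕ-Solver.solve-∀

  binom-step-sq′ : binom (2 ℕ.* suc n) (suc i) * (inv (suc k) * inv (suc k))
                 ≡ ρ n * (binom (2 ℕ.* n) i * (inv (suc k) * inv (suc k)))
                   + (inv (suc n) * inv (suc n)) * binom (2 ℕ.* suc n) (suc i)
  binom-step-sq′ = binom-sq-ratio
    {ofℕ (suc i)} {ofℕ (suc k)} {ofℕ (suc n)} {ofℕ (suc (2 ℕ.* n))} {inv (suc n)} {inv (suc k)}
    {binom (2 ℕ.* n) i} {binom (2 ℕ.* suc n) (suc i)} {e i}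
    (ofℕ-+ (suc i) (suc k)) (ofℕ*inv≡1 n) (ofℕ*inv≡1 k) absorb complement

  binom-step-diff′ : e (suc i) - e i ≡ inv (suc n) * (ofℕ (suc k) * binom (2 ℕ.* suc n) (suc i))
  binom-step-diff′ = binom-diff-ratio
    {ofℕ (suc i)} {ofℕ (suc k)} {ofℕ (suc n)} {inv (suc n)} {binom (2 ℕ.* suc n) (suc i)} {e i} {e (suc i)}
    (ofℕ-+ (suc i) (suc k)) (ofℕ*inv≡1 n) pascal absorb

binom-step-sq : ∀ {n k} → k < n →
  binom (2 ℕ.* suc n) (n ∸ k) * (inv (suc k) * inv (suc k))
    ≡ ρ n * (binom (2 ℕ.* n) (n ∸ suc k) * (inv (suc k) * inv (suc k)))
      + (inv (suc n) * inv (suc n)) * binom (2 ℕ.* suc n) (n ∸ k)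
binom-step-sq {n} {k} k<n =
  subst (λ j → Step n j (n ∸ suc k)) (sym (ℕ.+-∸-assoc 1 k<n))
    (subst (λ m → Step m (suc (n ∸ suc k)) (n ∸ suc k)) (ℕ.m∸n+n≡m k<n) (binom-step-sq′ (n ∸ suc k) k))
  where
  Step : ℕ → ℕ → ℕ → Set
  Step n j i = binom (2 ℕ.* suc n) j * (inv (suc k) * inv (suc k))
             ≡ ρ n * (binom (2 ℕ.* n) i * (inv (suc k) * inv (suc k)))
               + (inv (suc n) * inv (suc n)) * binom (2 ℕ.* suc n) j

binom-step-diff : ∀ {n k} → k < n →
  binom (suc (2 ℕ.* n)) (n ∸ k) - binom (suc (2 ℕ.* n)) (n ∸ suc k)
    ≡ inv (suc n) * (ofℕ (suc k) * binom (2 ℕ.* suc n) (n ∸ k))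
binom-step-diff {n} {k} k<n =
  subst (λ j → Step n j (n ∸ suc k)) (sym (ℕ.+-∸-assoc 1 k<n))
    (subst (λ m → Step m (suc (n ∸ suc k)) (n ∸ suc k)) (ℕ.m∸n+n≡m k<n) (binom-step-diff′ (n ∸ suc k) k))
  where
  Step : ℕ → ℕ → ℕ → Set
  Step n j i = binom (suc (2 ℕ.* n)) j - binom (suc (2 ℕ.* n)) i
             ≡ inv (suc n) * (ofℕ (suc k) * binom (2 ℕ.* suc n) j)

binom-∸-self-* : ∀ m n x → binom m (n ∸ n) * x ≡ x
binom-∸-self-* m n x = trans (cong (λ j → binom m j * x) (ℕ.n∸n≡0 n)) (*-identityˡ x)

Σᴮ : ℕ → ℕ → (ℕ → ℚ) → ℚ
Σᴮ m n f = Σ₁ n (λ k → binom m (n ∸ k) * f k)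

Σᴮ-cong : ∀ m n {f g : ℕ → ℚ} → (∀ k → k < n → f (suc k) ≡ g (suc k)) → Σᴮ m n f ≡ Σᴮ m n g
Σᴮ-cong m n f≗g = Σ₁-cong n (λ k k<n → cong (binom m (n ∸ suc k) *_) (f≗g k k<n))

Σᴮ-+ : ∀ m n (f g : ℕ → ℚ) → Σᴮ m n f + Σᴮ m n g ≡ Σᴮ m n (λ k → f k + g k)
Σᴮ-+ m n f g = trans (Σ₁-+ n _ _)
  (Σ₁-cong n (λ k _ → sym (*-distribˡ-+ (binom m (n ∸ suc k)) (f (suc k)) (g (suc k)))))

Σᴮ-*ˡ : ∀ m n a (f : ℕ → ℚ) → a * Σᴮ m n f ≡ Σᴮ m n (λ k → a * f k)
Σᴮ-*ˡ m n a f = trans (Σ₁-*ˡ n a _) (Σ₁-cong n (λ k _ → swap a (binom m (n ∸ suc k)) (f (suc k))))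
  where
  swap : ∀ a b x → a * (b * x) ≡ b * (a * x)
  swap = solve-∀ ℚ-ring

Σᴮ-- : ∀ m n (f g : ℕ → ℚ) → Σᴮ m n f - Σᴮ m n g ≡ Σᴮ m n (λ k → f k - g k)
Σᴮ-- m n f g = sym (trans
  (Σ₁-linear n 1ℚ (- 1ℚ) (λ k _ → distrib (binom m (n ∸ suc k)) (f (suc k)) (g (suc k))))
  (units (Σᴮ m n f) (Σᴮ m n g)))
  where
  distrib : ∀ b x y → b * (x - y) ≡ 1ℚ * (b * x) + (- 1ℚ) * (b * y)
  distrib = solve-∀ ℚ-ring
  units : ∀ x y → 1ℚ * x + (- 1ℚ) * y ≡ x - y
  units = solve-∀ ℚ-ring

Σᴮ-peelˡ : ∀ m n (f : ℕ → ℚ) → Σᴮ m (suc n) f ≡ binom m n * f 1 + Σᴮ m n (λ k → f (suc k))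
Σᴮ-peelˡ m n f = Σ₁-peelˡ n (λ k → binom m (suc n ∸ k) * f k)

Σᴮ-peelʳ : ∀ m n (f : ℕ → ℚ) → Σᴮ m (suc n) f ≡ Σ₁ n (λ k → binom m (suc (n ∸ k)) * f k) + f (suc n)
Σᴮ-peelʳ m n f = cong₂ _+_
  (Σ₁-cong n (λ k k<n → cong (λ j → binom m j * f (suc k)) (ℕ.+-∸-assoc 1 k<n)))
  (binom-∸-self-* m n (f (suc n)))

Σᴮ-pascal : ∀ m n (f : ℕ → ℚ) → Σᴮ (suc m) (suc n) f ≡ binom m n * f 1 + Σᴮ m n (λ k → f k + f (suc k))
Σᴮ-pascal m n f = begin
  Σᴮ (suc m) (suc n) f
    ≡⟨ Σᴮ-peelʳ (suc m) n f ⟩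
  Σ₁ n (λ k → binom (suc m) (suc (n ∸ k)) * f k) + f (suc n)
    ≡⟨ cong (_+ f (suc n)) (Σ₁-cong n (λ k _ → split (n ∸ suc k) (f (suc k)))) ⟩
  Σ₁ n (λ k → binom m (n ∸ k) * f k + binom m (suc (n ∸ k)) * f k) + f (suc n)
    ≡⟨ cong (_+ f (suc n)) (Σ₁-+ n _ _) ⟨
  (Σᴮ m n f + Σ₁ n (λ k → binom m (suc (n ∸ k)) * f k)) + f (suc n)
    ≡⟨ +-assoc (Σᴮ m n f) _ (f (suc n)) ⟩
  Σᴮ m n f + (Σ₁ n (λ k → binom m (suc (n ∸ k)) * f k) + f (suc n))
    ≡⟨ cong (Σᴮ m n f +_) (Σᴮ-peelʳ m n f) ⟨
  Σᴮ m n f + Σᴮ m (suc n) f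
    ≡⟨ cong (Σᴮ m n f +_) (Σᴮ-peelˡ m n f) ⟩
  Σᴮ m n f + (binom m n * f 1 + Σᴮ m n (λ k → f (suc k)))
    ≡⟨ rotate (Σᴮ m n f) (binom m n * f 1) _ ⟩
  binom m n * f 1 + (Σᴮ m n f + Σᴮ m n (λ k → f (suc k)))
    ≡⟨ cong (binom m n * f 1 +_) (Σᴮ-+ m n f (λ k → f (suc k))) ⟩
  binom m n * f 1 + Σᴮ m n (λ k → f k + f (suc k)) ∎
  where
  open ≡-Reasoning
  split : ∀ j x → binom (suc m) (suc j) * x ≡ binom m j * x + binom m (suc j) * x
  split j x = trans (cong (_* x) (binom-pascal m j)) (*-distribʳ-+ x (binom m j) (binom m (suc j)))
  rotate : ∀ a b c → a + (b + c) ≡ b + (a + c)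
  rotate = solve-∀ ℚ-ring

Σᴮ-step-sq : ∀ n (f : ℕ → ℚ) →
  Σᴮ (2 ℕ.* suc n) (suc n) (λ k → f k * inv (k ℕ.* k))
    ≡ ρ n * Σᴮ (2 ℕ.* n) n (λ k → f k * inv (k ℕ.* k)) + inv (suc n ℕ.* suc n) * Σᴮ (2 ℕ.* suc n) (suc n) f
Σᴮ-step-sq n f = begin
  Σ₁ n F′ + F′ (suc n)                      ≡⟨ cong (_+ F′ (suc n)) (Σ₁-linear n (ρ n) q terms) ⟩
  (ρ n * Σ₁ n F + q * Σ₁ n G) + F′ (suc n)   ≡⟨ cong (λ x → (ρ n * Σ₁ n F + q * Σ₁ n G) + x) last ⟩
  (ρ n * Σ₁ n F + q * Σ₁ n G) + q * G (suc n) ≡⟨ collect (ρ n) q (Σ₁ n F) (Σ₁ n G) (G (suc n)) ⟩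
  ρ n * Σ₁ n F + q * (Σ₁ n G + G (suc n))   ∎
  where
  open ≡-Reasoning
  q = inv (suc n ℕ.* suc n)
  F′ F G : ℕ → ℚ
  F′ k = binom (2 ℕ.* suc n) (suc n ∸ k) * (f k * inv (k ℕ.* k))
  F  k = binom (2 ℕ.* n) (n ∸ k) * (f k * inv (k ℕ.* k))
  G  k = binom (2 ℕ.* suc n) (suc n ∸ k) * f k
  scale : ∀ B′ B r c x y → B′ * x ≡ r * (B * x) + c * B′ → B′ * (y * x) ≡ r * (B * (y * x)) + c * (B′ * y)
  scale B′ B r c x y eq = begin
    B′ * (y * x)               ≡⟨ solve (B′ ∷ x ∷ y ∷ []) ℚ-ring ⟩
    (B′ * x) * y               ≡⟨ cong (_* y) eq ⟩
    (r * (B * x) + c * B′) * y ≡⟨ solve (B′ ∷ B ∷ r ∷ c ∷ x ∷ y ∷ []) ℚ-ring ⟩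
    r * (B * (y * x)) + c * (B′ * y) ∎
  terms : ∀ k → k < n → F′ (suc k) ≡ ρ n * F (suc k) + q * G (suc k)
  terms k k<n = begin
    B′ * (y * inv (suc k ℕ.* suc k))
      ≡⟨ cong (λ z → B′ * (y * z)) (inv-* k k) ⟩
    B′ * (y * (inv (suc k) * inv (suc k)))
      ≡⟨ scale B′ B (ρ n) (inv (suc n) * inv (suc n)) _ y (binom-step-sq k<n) ⟩
    ρ n * (B * (y * (inv (suc k) * inv (suc k)))) + (inv (suc n) * inv (suc n)) * (B′ * y)
      ≡⟨ cong₂ (λ z w → ρ n * (B * (y * z)) + w * (B′ * y)) (inv-* k k) (inv-* n n) ⟨
    ρ n * (B * (y * inv (suc k ℕ.* suc k))) + q * (B′ * y) ∎
    where
    B′ = binom (2 ℕ.* suc n) (n ∸ k)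
    B  = binom (2 ℕ.* n) (n ∸ suc k)
    y  = f (suc k)
  last : F′ (suc n) ≡ q * G (suc n)
  last = reorder (binom (2 ℕ.* suc n) (n ∸ n)) (f (suc n)) q
    where
    reorder : ∀ b x q → b * (x * q) ≡ q * (b * x)
    reorder = solve-∀ ℚ-ring
  collect : ∀ r q x y z → (r * x + q * y) + q * z ≡ r * x + q * (y + z)
  collect = solve-∀ ℚ-ring

Σᴮ-odd-difference : ∀ n (f : ℕ → ℚ) →
  Σᴮ (suc (2 ℕ.* n)) (suc n) f - Σᴮ (suc (2 ℕ.* n)) n f
    ≡ inv (suc n) * Σᴮ (2 ℕ.* suc n) (suc n) (λ k → ofℕ k * f k)
Σᴮ-odd-difference n f = begin
  (Σ₁ n F + F (suc n)) - Σ₁ n G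
    ≡⟨ cong (λ x → (x + F (suc n)) - Σ₁ n G) (Σ₁-linear n 1ℚ iN terms) ⟩
  ((1ℚ * Σ₁ n G + iN * Σ₁ n H) + F (suc n)) - Σ₁ n G
    ≡⟨ cong (λ x → ((1ℚ * Σ₁ n G + iN * Σ₁ n H) + x) - Σ₁ n G) last ⟩
  ((1ℚ * Σ₁ n G + iN * Σ₁ n H) + iN * H (suc n)) - Σ₁ n G
    ≡⟨ cancel iN (Σ₁ n G) (Σ₁ n H) (H (suc n)) ⟩
  iN * (Σ₁ n H + H (suc n)) ∎
  where
  open ≡-Reasoning
  iN = inv (suc n)
  F G H : ℕ → ℚ
  F k = binom (suc (2 ℕ.* n)) (suc n ∸ k) * f k
  G k = binom (suc (2 ℕ.* n)) (n ∸ k) * f k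
  H k = binom (2 ℕ.* suc n) (suc n ∸ k) * (ofℕ k * f k)
  terms : ∀ k → k < n → F (suc k) ≡ 1ℚ * G (suc k) + iN * H (suc k)
  terms k k<n = begin
    e₁ * y                              ≡⟨ split e₀ e₁ y ⟩
    1ℚ * (e₀ * y) + (e₁ - e₀) * y       ≡⟨ cong (λ d → 1ℚ * (e₀ * y) + d * y) (binom-step-diff k<n) ⟩
    1ℚ * (e₀ * y) + (iN * (K * B′)) * y ≡⟨ reassoc e₀ iN K B′ y ⟩
    1ℚ * (e₀ * y) + iN * (B′ * (K * y)) ∎
    where
    e₀ = binom (suc (2 ℕ.* n)) (n ∸ suc k)
    e₁ = binom (suc (2 ℕ.* n)) (n ∸ k)
    B′ = binom (2 ℕ.* suc n) (n ∸ k)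
    K  = ofℕ (suc k)
    y  = f (suc k)
    split : ∀ e₀ e₁ y → e₁ * y ≡ 1ℚ * (e₀ * y) + (e₁ - e₀) * y
    split = solve-∀ ℚ-ring
    reassoc : ∀ e₀ iN K B′ y → 1ℚ * (e₀ * y) + (iN * (K * B′)) * y ≡ 1ℚ * (e₀ * y) + iN * (B′ * (K * y))
    reassoc = solve-∀ ℚ-ring
  last : F (suc n) ≡ iN * H (suc n)
  last = begin
    F (suc n)                       ≡⟨ binom-∸-self-* (suc (2 ℕ.* n)) n (f (suc n)) ⟩
    f (suc n)                       ≡⟨ ofℕ*x≡y⇒x≡inv*y n refl ⟩
    iN * (ofℕ (suc n) * f (suc n))  ≡⟨ cong (iN *_) (binom-∸-self-* (2 ℕ.* suc n) n _) ⟨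
    iN * H (suc n)                  ∎
  cancel : ∀ iN g h h′ → ((1ℚ * g + iN * h) + iN * h′) - g ≡ iN * (h + h′)
  cancel = solve-∀ ℚ-ring

record LucasRecurrence (s : ℚ) (f : ℕ → ℚ) : Set where
  field step : ∀ k → f (suc (suc k)) ≡ s * f (suc k) - f k
open LucasRecurrence

module _ {s : ℚ} where

  recurrence-shift : ∀ {f} → LucasRecurrence s f → LucasRecurrence s (λ k → f (suc k))
  recurrence-shift rec .step k = rec .step (suc k)

  recurrence-+ : ∀ {f g} → LucasRecurrence s f → LucasRecurrence s g → LucasRecurrence s (λ k → f k + g k)
  recurrence-+ {f} {g} recf recg .step k =
    trans (cong₂ _+_ (recf .step k) (recg .step k)) (regroup s (f k) (f (suc k)) (g k) (g (suc k)))
    where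
    regroup : ∀ s a b c d → (s * b - a) + (s * d - c) ≡ s * (b + d) - (a + c)
    regroup = solve-∀ ℚ-ring

  recurrence-- : ∀ {f g} → LucasRecurrence s f → LucasRecurrence s g → LucasRecurrence s (λ k → f k - g k)
  recurrence-- {f} {g} recf recg .step k =
    trans (cong₂ _-_ (recf .step k) (recg .step k)) (regroup s (f k) (f (suc k)) (g k) (g (suc k)))
    where
    regroup : ∀ s a b c d → (s * b - a) - (s * d - c) ≡ s * (b - d) - (a - c)
    regroup = solve-∀ ℚ-ring

  recurrence-*ˡ : ∀ c {f} → LucasRecurrence s f → LucasRecurrence s (λ k → c * f k)
  recurrence-*ˡ c {f} recf .step k = trans (cong (c *_) (recf .step k)) (regroup s c (f k) (f (suc k)))
    where
    regroup : ∀ s c a b → c * (s * b - a) ≡ s * (c * b) - c * a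
    regroup = solve-∀ ℚ-ring

  recurrence-unique : ∀ {f g} → LucasRecurrence s f → LucasRecurrence s g →
                      f 0 ≡ g 0 → f 1 ≡ g 1 → ∀ k → f k ≡ g k
  recurrence-unique recf recg f₀≡g₀ f₁≡g₁ zero          = f₀≡g₀
  recurrence-unique recf recg f₀≡g₀ f₁≡g₁ (suc zero)    = f₁≡g₁
  recurrence-unique recf recg f₀≡g₀ f₁≡g₁ (suc (suc k)) = trans (recf .step k) (trans
    (cong₂ (λ x y → s * x - y) (recurrence-unique recf recg f₀≡g₀ f₁≡g₁ (suc k))
                               (recurrence-unique recf recg f₀≡g₀ f₁≡g₁ k))
    (sym (recg .step k)))

u-recurrence : ∀ s → LucasRecurrence s (λ k → u k s)
u-recurrence s .step k = refl

v-recurrence : ∀ s → LucasRecurrence s (λ k → v k s)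
v-recurrence s .step k = refl

u[k+2]-u[k]≡v[k+1] : ∀ s k → u (suc (suc k)) s - u k s ≡ v (suc k) s
u[k+2]-u[k]≡v[k+1] s = recurrence-unique
  (recurrence-- (recurrence-shift (recurrence-shift (u-recurrence s))) (u-recurrence s))
  (recurrence-shift (v-recurrence s))
  (at-0 s) (at-1 s)
  where
  at-0 : ∀ s → (s * 1ℚ - 0ℚ) - 0ℚ ≡ s
  at-0 = solve-∀ ℚ-ring
  at-1 : ∀ s → (s * (s * 1ℚ - 0ℚ) - 1ℚ) - 1ℚ ≡ s * s - ofℕ 2
  at-1 = solve-∀ ℚ-ring

[s+2]*[u[k+1]-u[k]]≡v[k]+v[k+1] : ∀ s k → (s + ofℕ 2) * (u (suc k) s - u k s) ≡ v k s + v (suc k) s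
[s+2]*[u[k+1]-u[k]]≡v[k]+v[k+1] s = recurrence-unique
  (recurrence-*ˡ (s + ofℕ 2) (recurrence-- (recurrence-shift (u-recurrence s)) (u-recurrence s)))
  (recurrence-+ (v-recurrence s) (recurrence-shift (v-recurrence s)))
  (at-0 s) (at-1 s)
  where
  at-0 : ∀ s → (s + ofℕ 2) * (1ℚ - 0ℚ) ≡ ofℕ 2 + s
  at-0 = solve-∀ ℚ-ring
  at-1 : ∀ s → (s + ofℕ 2) * ((s * 1ℚ - 0ℚ) - 1ℚ) ≡ s + (s * s - ofℕ 2)
  at-1 = solve-∀ ℚ-ring

module Rows (t : ℚ) where

  s : ℚ
  s = t - ofℕ 2

  u′ v′ Δu : ℕ → ℚ
  u′ k = u k s
  v′ k = v k s
  Δu k = u′ k - u′ (k ∸ 1)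

  EvenRow OddRow : ℕ → Set
  EvenRow n = Σᴮ (2 ℕ.* n) n v′ + binom (2 ℕ.* n) n ≡ t ^ n
  OddRow  n = Σᴮ (suc (2 ℕ.* n)) (suc n) Δu ≡ t ^ n

  even⇒odd : ∀ n → EvenRow n → OddRow n
  even⇒odd n even = begin
    Σᴮ (suc (2 ℕ.* n)) (suc n) Δu
      ≡⟨ Σᴮ-pascal (2 ℕ.* n) n Δu ⟩
    c * Δu 1 + Σᴮ (2 ℕ.* n) n (λ k → Δu k + Δu (suc k))
      ≡⟨ cong (c * Δu 1 +_) (Σᴮ-cong (2 ℕ.* n) n (λ k _ → telescope k)) ⟩
    c * (1ℚ - 0ℚ) + Σᴮ (2 ℕ.* n) n v′
      ≡⟨ swap c (Σᴮ (2 ℕ.* n) n v′) ⟩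
    Σᴮ (2 ℕ.* n) n v′ + c
      ≡⟨ even ⟩
    t ^ n ∎
    where
    open ≡-Reasoning
    c = binom (2 ℕ.* n) n
    telescope : ∀ k → Δu (suc k) + Δu (suc (suc k)) ≡ v′ (suc k)
    telescope k = trans (sum-of-differences (u k s) (u (suc k) s) (u (suc (suc k)) s)) (u[k+2]-u[k]≡v[k+1] s k)
      where
      sum-of-differences : ∀ a b c → (b - a) + (c - b) ≡ c - a
      sum-of-differences = solve-∀ ℚ-ring
    swap : ∀ c x → c * (1ℚ - 0ℚ) + x ≡ x + c
    swap = solve-∀ ℚ-ring

  odd⇒even : ∀ n → OddRow n → EvenRow (suc n)
  odd⇒even n odd = begin
    Σᴮ (2 ℕ.* suc n) (suc n) v′ + binom (2 ℕ.* suc n) (suc n)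
      ≡⟨ cong₂ _+_ (cong (λ m → Σᴮ m (suc n) v′) (2[1+n]≡2+2n n)) (binom-central-pascal n) ⟩
    Σᴮ (suc M) (suc n) v′ + ofℕ 2 * e n
      ≡⟨ cong (_+ ofℕ 2 * e n) (Σᴮ-pascal M n v′) ⟩
    (e n * v′ 1 + Σᴮ M n (λ k → v′ k + v′ (suc k))) + ofℕ 2 * e n
      ≡⟨ regroup (e n) (v′ 1) (Σᴮ M n (λ k → v′ k + v′ (suc k))) ⟩
    e n * (v′ 0 + v′ 1) + Σᴮ M n (λ k → v′ k + v′ (suc k))
      ≡⟨ Σᴮ-peelˡ M n (λ k → v′ (k ∸ 1) + v′ k) ⟨
    Σᴮ M (suc n) (λ k → v′ (k ∸ 1) + v′ k)
      ≡⟨ Σᴮ-cong M (suc n) (λ k _ → t*Δu k) ⟨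
    Σᴮ M (suc n) (λ k → t * Δu k)
      ≡⟨ Σᴮ-*ˡ M (suc n) t Δu ⟨
    t * Σᴮ M (suc n) Δu
      ≡⟨ cong (t *_) odd ⟩
    t * t ^ n ∎
    where
    open ≡-Reasoning
    M = suc (2 ℕ.* n)
    e = binom M
    regroup : ∀ e a x → (e * a + x) + ofℕ 2 * e ≡ e * (ofℕ 2 + a) + x
    regroup = solve-∀ ℚ-ring
    t≡s+2 : t ≡ s + ofℕ 2
    t≡s+2 = lemma t
      where
      lemma : ∀ t → t ≡ (t - ofℕ 2) + ofℕ 2
      lemma = solve-∀ ℚ-ring
    t*Δu : ∀ k → t * Δu (suc k) ≡ v′ k + v′ (suc k)
    t*Δu k = trans (cong (_* Δu (suc k)) t≡s+2) ([s+2]*[u[k+1]-u[k]]≡v[k]+v[k+1] s k)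

  even-row : ∀ n → EvenRow n
  even-row zero    = refl
  even-row (suc n) = odd⇒even n (even⇒odd n (even-row n))

  odd-row-difference : ∀ n → Σᴮ (suc (2 ℕ.* n)) (suc n) u′ - Σᴮ (suc (2 ℕ.* n)) n u′ ≡ t ^ n
  odd-row-difference n = begin
    Σᴮ M (suc n) u′ - Σᴮ M n u′
      ≡⟨ cong (λ x → Σᴮ M (suc n) u′ - x) (trans (Σᴮ-peelˡ M n (λ k → u′ (k ∸ 1))) (drop (binom M n) _)) ⟨
    Σᴮ M (suc n) u′ - Σᴮ M (suc n) (λ k → u′ (k ∸ 1))
      ≡⟨ Σᴮ-- M (suc n) u′ (λ k → u′ (k ∸ 1)) ⟩
    Σᴮ M (suc n) Δu
      ≡⟨ even⇒odd n (even-row n) ⟩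
    t ^ n ∎
    where
    open ≡-Reasoning
    M = suc (2 ℕ.* n)
    drop : ∀ c x → c * 0ℚ + x ≡ x
    drop = solve-∀ ℚ-ring

binom-central-*-Σ₁ : ∀ n (F : ℕ → ℚ) →
  binom (2 ℕ.* suc n) (suc n) * Σ₁ (suc n) F
    ≡ ρ n * (binom (2 ℕ.* n) n * Σ₁ n F) + binom (2 ℕ.* suc n) (suc n) * F (suc n)
binom-central-*-Σ₁ n F = begin
  c′ * (Σ₁ n F + F (suc n))           ≡⟨ *-distribˡ-+ c′ (Σ₁ n F) (F (suc n)) ⟩
  c′ * Σ₁ n F + c′ * F (suc n)        ≡⟨ cong (λ x → x * Σ₁ n F + c′ * F (suc n)) (binom-central-suc n) ⟩
  (ρ n * c) * Σ₁ n F + c′ * F (suc n) ≡⟨ cong (_+ c′ * F (suc n)) (*-assoc (ρ n) c (Σ₁ n F)) ⟩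
  ρ n * (c * Σ₁ n F) + c′ * F (suc n) ∎
  where
  open ≡-Reasoning
  c′ = binom (2 ℕ.* suc n) (suc n)
  c  = binom (2 ℕ.* n) n

lhs-step : ∀ n d x (F : ℕ → ℚ) → 0 < d → F (suc n) ≡ x * inv (d ℕ.* cb (suc n)) →
           binom (2 ℕ.* suc n) (suc n) * Σ₁ (suc n) F ≡ ρ n * (binom (2 ℕ.* n) n * Σ₁ n F) + inv d * x
lhs-step n d x F 0<d last = trans (binom-central-*-Σ₁ n F) (cong (ρ n * (binom (2 ℕ.* n) n * Σ₁ n F) +_) (begin
  c * F (suc n)                          ≡⟨ cong (c *_) last ⟩
  c * (x * inv (d ℕ.* cb (suc n)))       ≡⟨ reorder c x _ ⟩
  (c * inv (d ℕ.* cb (suc n))) * x       ≡⟨ cong (_* x) (ofℕ[c]*inv[d*c]≡inv[d] 0<d (C-pos (ℕ.m≤m+n (suc n) (suc n ℕ.+ 0)))) ⟩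
  inv d * x                              ∎))
  where
  open ≡-Reasoning
  c = binom (2 ℕ.* suc n) (suc n)
  reorder : ∀ c x y → c * (x * y) ≡ (c * y) * x
  reorder = solve-∀ ℚ-ring

module Identities (t : ℚ) where
  open Rows t
  open ≡-Reasoning

  identity₁ : ∀ n → lhs1 n t ≡ rhs1 n t
  identity₁ = same-recurrence⇒≡ ρ (λ n → inv (suc n) * t ^ n) (*-zeroʳ (binom 0 0)) lhs-rec rhs-rec
    where
    U : ℕ → ℚ
    U k = ofℕ k * u′ k

    rhs1-Σᴮ : ∀ m → rhs1 m t ≡ Σᴮ (2 ℕ.* m) m (λ k → U k * inv (k ℕ.* k))
    rhs1-Σᴮ m = Σ₁-cong m term
      where
      term : ∀ k → k < m → binom (2 ℕ.* m) (m ∸ suc k) * u′ (suc k) * inv (suc k)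
                           ≡ binom (2 ℕ.* m) (m ∸ suc k) * (U (suc k) * inv (suc k ℕ.* suc k))
      term k _ = begin
        b * u′ (suc k) * inv (suc k)            ≡⟨ *-assoc b (u′ (suc k)) (inv (suc k)) ⟩
        b * (u′ (suc k) * inv (suc k))          ≡⟨ cong (b *_) (unfold (u′ (suc k))) ⟨
        b * (U (suc k) * inv (suc k ℕ.* suc k))  ∎
        where
        b = binom (2 ℕ.* m) (m ∸ suc k)
        unfold : ∀ x → (ofℕ (suc k) * x) * inv (suc k ℕ.* suc k) ≡ x * inv (suc k)
        unfold x = begin
          (ofℕ (suc k) * x) * inv (suc k ℕ.* suc k)        ≡⟨ cong ((ofℕ (suc k) * x) *_) (inv-* k k) ⟩
          (ofℕ (suc k) * x) * (inv (suc k) * inv (suc k))  ≡⟨ reassoc (ofℕ (suc k)) x (inv (suc k)) ⟩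
          ofℕ (suc k) * ((x * inv (suc k)) * inv (suc k))  ≡⟨ ofℕ*[x*inv]≡x k (x * inv (suc k)) ⟩
          x * inv (suc k)                                  ∎
          where
          reassoc : ∀ K x i → (K * x) * (i * i) ≡ K * ((x * i) * i)
          reassoc = solve-∀ ℚ-ring

    lhs-rec : ∀ n → lhs1 (suc n) t ≡ ρ n * lhs1 n t + inv (suc n) * t ^ n
    lhs-rec n = lhs-step n (suc n) (t ^ n) _ (s≤s z≤n) refl

    rhs-rec : ∀ n → rhs1 (suc n) t ≡ ρ n * rhs1 n t + inv (suc n) * t ^ n
    rhs-rec n = begin
      rhs1 (suc n) t
        ≡⟨ rhs1-Σᴮ (suc n) ⟩
      Σᴮ (2 ℕ.* suc n) (suc n) (λ k → U k * inv (k ℕ.* k))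
        ≡⟨ Σᴮ-step-sq n U ⟩
      ρ n * Σᴮ (2 ℕ.* n) n (λ k → U k * inv (k ℕ.* k)) + inv (suc n ℕ.* suc n) * Σᴮ (2 ℕ.* suc n) (suc n) U
        ≡⟨ cong₂ (λ x y → ρ n * x + y) (sym (rhs1-Σᴮ n)) (begin
          inv (suc n ℕ.* suc n) * Σᴮ (2 ℕ.* suc n) (suc n) U
            ≡⟨ cong (_* Σᴮ (2 ℕ.* suc n) (suc n) U) (inv-* n n) ⟩
          (inv (suc n) * inv (suc n)) * Σᴮ (2 ℕ.* suc n) (suc n) U
            ≡⟨ *-assoc (inv (suc n)) (inv (suc n)) _ ⟩
          inv (suc n) * (inv (suc n) * Σᴮ (2 ℕ.* suc n) (suc n) U)
            ≡⟨ cong (inv (suc n) *_) (Σᴮ-odd-difference n u′) ⟨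
          inv (suc n) * (Σᴮ (suc (2 ℕ.* n)) (suc n) u′ - Σᴮ (suc (2 ℕ.* n)) n u′)
            ≡⟨ cong (inv (suc n) *_) (odd-row-difference n) ⟩
          inv (suc n) * t ^ n ∎) ⟩
      ρ n * rhs1 n t + inv (suc n) * t ^ n ∎

  identity₂ : ∀ n → lhs2 n t ≡ rhs2 n t
  identity₂ = same-recurrence⇒≡ ρ (λ n → inv (suc n ℕ.* suc n) * t ^ suc n) refl lhs-rec rhs-rec
    where
    H : ℕ → ℚ
    H m = Σ₁ m (λ k → inv (k ℕ.* k))

    rhs2-Σᴮ : ∀ m → rhs2 m t ≡ Σᴮ (2 ℕ.* m) m (λ k → v′ k * inv (k ℕ.* k)) + binom (2 ℕ.* m) m * H m
    rhs2-Σᴮ m = cong (_+ binom (2 ℕ.* m) m * H m)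
      (Σ₁-cong m (λ k _ → *-assoc (binom (2 ℕ.* m) (m ∸ suc k)) (v′ (suc k)) (inv (suc k ℕ.* suc k))))

    lhs-rec : ∀ n → lhs2 (suc n) t ≡ ρ n * lhs2 n t + inv (suc n ℕ.* suc n) * t ^ suc n
    lhs-rec n = lhs-step n (suc n ℕ.* suc n) (t ^ suc n) _ (s≤s z≤n) refl

    rhs-rec : ∀ n → rhs2 (suc n) t ≡ ρ n * rhs2 n t + inv (suc n ℕ.* suc n) * t ^ suc n
    rhs-rec n = begin
      rhs2 (suc n) t
        ≡⟨ rhs2-Σᴮ (suc n) ⟩
      Σᴮ (2 ℕ.* suc n) (suc n) (λ k → v′ k * inv (k ℕ.* k)) + c′ * H (suc n)
        ≡⟨ cong₂ _+_ (Σᴮ-step-sq n v′) (binom-central-*-Σ₁ n (λ k → inv (k ℕ.* k))) ⟩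
      (ρ n * S + q * Σᴮ (2 ℕ.* suc n) (suc n) v′) + (ρ n * (c * H n) + c′ * q)
        ≡⟨ regroup (ρ n) S q (Σᴮ (2 ℕ.* suc n) (suc n) v′) (c * H n) c′ ⟩
      ρ n * (S + c * H n) + q * (Σᴮ (2 ℕ.* suc n) (suc n) v′ + c′)
        ≡⟨ cong₂ (λ x y → ρ n * x + q * y) (sym (rhs2-Σᴮ n)) (even-row (suc n)) ⟩
      ρ n * rhs2 n t + q * t ^ suc n ∎
      where
      S = Σᴮ (2 ℕ.* n) n (λ k → v′ k * inv (k ℕ.* k))
      q = inv (suc n ℕ.* suc n)
      c = binom (2 ℕ.* n) n
      c′ = binom (2 ℕ.* suc n) (suc n)
      regroup : ∀ r S q V C c′ → (r * S + q * V) + (r * C + c′ * q) ≡ r * (S + C) + q * (V + c′)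
      regroup = solve-∀ ℚ-ring

  identity₃ : ∀ n → lhs3 n t ≡ rhs3 n t
  identity₃ = same-recurrence⇒≡ ρ (λ n → inv (suc n ℕ.* suc n ℕ.* suc n) * t ^ suc n) refl lhs-rec rhs-rec
    where
    h W g H : ℕ → ℚ
    h k = v′ k * inv k
    W k = Σ₁ (k ∸ 1) (λ j → sgn (k ∸ j) * h j)
    g k = h k + ofℕ 2 * W k
    H m = Σ₁ m (λ k → inv (k ℕ.* k ℕ.* k))

    W-step : ∀ k → W (suc (suc k)) ≡ - W (suc k) - h (suc k)
    W-step k = begin
      Σ₁ k (λ j → sgn (suc (suc k) ∸ j) * h j) + sgn (suc k ∸ k) * h (suc k)
        ≡⟨ cong₂ _+_ (sym (trans (Σ₁-*ˡ k (- 1ℚ) _) (Σ₁-cong k flip)))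
                     (cong (λ i → sgn i * h (suc k)) [1+k]∸k≡1) ⟩
      (- 1ℚ) * W (suc k) + (- 1ℚ) * h (suc k)
        ≡⟨ negate (W (suc k)) (h (suc k)) ⟩
      - W (suc k) - h (suc k) ∎
      where
      [1+k]∸k≡1 : suc k ∸ k ≡ 1
      [1+k]∸k≡1 = trans (ℕ.+-∸-assoc 1 (ℕ.≤-refl {k})) (cong suc (ℕ.n∸n≡0 k))
      flip : ∀ j → j < k → (- 1ℚ) * (sgn (k ∸ j) * h (suc j)) ≡ sgn (suc k ∸ j) * h (suc j)
      flip j j<k = trans (neg-* (sgn (k ∸ j)) (h (suc j)))
                         (cong (λ i → sgn i * h (suc j)) (sym (ℕ.+-∸-assoc 1 (ℕ.<⇒≤ j<k))))
        where
        neg-* : ∀ x y → (- 1ℚ) * (x * y) ≡ (- x) * y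
        neg-* = solve-∀ ℚ-ring
      negate : ∀ w x → (- 1ℚ) * w + (- 1ℚ) * x ≡ - w - x
      negate = solve-∀ ℚ-ring

    pairs : ∀ k → g (suc k) + g (suc (suc k)) ≡ h (suc (suc k)) - h (suc k)
    pairs k = trans (cong (λ w → g (suc k) + (h (suc (suc k)) + ofℕ 2 * w)) (W-step k))
                    (cancel (h (suc k)) (h (suc (suc k))) (W (suc k)))
      where
      cancel : ∀ h₁ h₂ w → (h₁ + ofℕ 2 * w) + (h₂ + ofℕ 2 * (- w - h₁)) ≡ h₂ - h₁
      cancel = solve-∀ ℚ-ring

    g-identity : ∀ n → Σᴮ (2 ℕ.* suc n) (suc n) g ≡ inv (suc n) * Σᴮ (2 ℕ.* suc n) (suc n) v′
    g-identity n = begin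
      Σᴮ (2 ℕ.* suc n) (suc n) g
        ≡⟨ cong (λ m → Σᴮ m (suc n) g) (2[1+n]≡2+2n n) ⟩
      Σᴮ (suc M) (suc n) g
        ≡⟨ Σᴮ-pascal M n g ⟩
      e n * g 1 + Σᴮ M n (λ k → g k + g (suc k))
        ≡⟨ cong₂ (λ x y → e n * x + y) (drop (h 1)) (Σᴮ-cong M n (λ k _ → pairs k)) ⟩
      e n * h 1 + Σᴮ M n (λ k → h (suc k) - h k)
        ≡⟨ cong (e n * h 1 +_) (Σᴮ-- M n (λ k → h (suc k)) h) ⟨
      e n * h 1 + (Σᴮ M n (λ k → h (suc k)) - Σᴮ M n h)
        ≡⟨ +-assoc-minus (e n * h 1) (Σᴮ M n (λ k → h (suc k))) (Σᴮ M n h) ⟩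
      (e n * h 1 + Σᴮ M n (λ k → h (suc k))) - Σᴮ M n h
        ≡⟨ cong (_- Σᴮ M n h) (Σᴮ-peelˡ M n h) ⟨
      Σᴮ M (suc n) h - Σᴮ M n h
        ≡⟨ Σᴮ-odd-difference n h ⟩
      inv (suc n) * Σᴮ (2 ℕ.* suc n) (suc n) (λ k → ofℕ k * h k)
        ≡⟨ cong (inv (suc n) *_) (Σᴮ-cong (2 ℕ.* suc n) (suc n) (λ k _ → ofℕ*[x*inv]≡x k (v′ (suc k)))) ⟩
      inv (suc n) * Σᴮ (2 ℕ.* suc n) (suc n) v′ ∎
      where
      M = suc (2 ℕ.* n)
      e = binom M
      drop : ∀ x → x + ofℕ 2 * 0ℚ ≡ x
      drop = solve-∀ ℚ-ring
      +-assoc-minus : ∀ a b c → a + (b - c) ≡ (a + b) - c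
      +-assoc-minus = solve-∀ ℚ-ring

    rhs3-Σᴮ : ∀ m → rhs3 m t ≡ Σᴮ (2 ℕ.* m) m (λ k → g k * inv (k ℕ.* k)) + binom (2 ℕ.* m) m * H m
    rhs3-Σᴮ m = cong (_+ binom (2 ℕ.* m) m * H m) (begin
      Σ₁ m (λ k → b k * v′ k * inv (k ℕ.* k ℕ.* k))
        + ofℕ 2 * Σ₁ m (λ k → Σ₁ (k ∸ 1) (λ j → b k * sgn (k ∸ j) * v′ j * inv (j ℕ.* k ℕ.* k)))
        ≡⟨ cong₂ (λ x y → x + ofℕ 2 * y) (Σ₁-cong m single) (Σ₁-cong m double) ⟩
      Σᴮ (2 ℕ.* m) m (λ k → h k * inv (k ℕ.* k)) + ofℕ 2 * Σᴮ (2 ℕ.* m) m (λ k → W k * inv (k ℕ.* k))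
        ≡⟨ cong (Σᴮ (2 ℕ.* m) m (λ k → h k * inv (k ℕ.* k)) +_) (Σᴮ-*ˡ (2 ℕ.* m) m (ofℕ 2) _) ⟩
      Σᴮ (2 ℕ.* m) m (λ k → h k * inv (k ℕ.* k)) + Σᴮ (2 ℕ.* m) m (λ k → ofℕ 2 * (W k * inv (k ℕ.* k)))
        ≡⟨ Σᴮ-+ (2 ℕ.* m) m _ _ ⟩
      Σᴮ (2 ℕ.* m) m (λ k → h k * inv (k ℕ.* k) + ofℕ 2 * (W k * inv (k ℕ.* k)))
        ≡⟨ Σᴮ-cong (2 ℕ.* m) m (λ k _ → factor (h (suc k)) (W (suc k)) (inv (suc k ℕ.* suc k))) ⟩
      Σᴮ (2 ℕ.* m) m (λ k → g k * inv (k ℕ.* k)) ∎)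
      where
      b : ℕ → ℚ
      b k = binom (2 ℕ.* m) (m ∸ k)
      factor : ∀ x w q → x * q + ofℕ 2 * (w * q) ≡ (x + ofℕ 2 * w) * q
      factor = solve-∀ ℚ-ring
      single : ∀ k → k < m → b (suc k) * v′ (suc k) * inv (suc k ℕ.* suc k ℕ.* suc k)
                             ≡ b (suc k) * (h (suc k) * inv (suc k ℕ.* suc k))
      single k _ = trans (cong (b (suc k) * v′ (suc k) *_) (inv-* (k ℕ.+ k ℕ.* suc k) k))
                         (reassoc (b (suc k)) (v′ (suc k)) (inv (suc k ℕ.* suc k)) (inv (suc k)))
        where
        reassoc : ∀ b x q i → b * x * (q * i) ≡ b * ((x * i) * q)
        reassoc = solve-∀ ℚ-ring
      double : ∀ k → k < m → Σ₁ k (λ j → b (suc k) * sgn (suc k ∸ j) * v′ j * inv (j ℕ.* suc k ℕ.* suc k))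
                             ≡ b (suc k) * (W (suc k) * inv (suc k ℕ.* suc k))
      double k _ = sym (trans (reassoc (b (suc k)) (W (suc k)) q) (trans (Σ₁-*ˡ k (b (suc k) * q) _) (Σ₁-cong k term)))
        where
        q = inv (suc k ℕ.* suc k)
        reassoc : ∀ b w q → b * (w * q) ≡ (b * q) * w
        reassoc = solve-∀ ℚ-ring
        term : ∀ j → j < k → (b (suc k) * q) * (sgn (suc k ∸ suc j) * h (suc j))
                             ≡ b (suc k) * sgn (suc k ∸ suc j) * v′ (suc j) * inv (suc j ℕ.* suc k ℕ.* suc k)
        term j _ = begin
          (b (suc k) * q) * (sgn (k ∸ j) * (v′ (suc j) * inv (suc j)))
            ≡⟨ cong (λ x → (b (suc k) * x) * (sgn (k ∸ j) * (v′ (suc j) * inv (suc j)))) (inv-* k k) ⟩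
          (b (suc k) * (inv (suc k) * inv (suc k))) * (sgn (k ∸ j) * (v′ (suc j) * inv (suc j)))
            ≡⟨ reorder (b (suc k)) (sgn (k ∸ j)) (v′ (suc j)) (inv (suc j)) (inv (suc k)) ⟩
          b (suc k) * sgn (k ∸ j) * v′ (suc j) * ((inv (suc j) * inv (suc k)) * inv (suc k))
            ≡⟨ cong (λ x → b (suc k) * sgn (k ∸ j) * v′ (suc j) * (x * inv (suc k))) (inv-* j k) ⟨
          b (suc k) * sgn (k ∸ j) * v′ (suc j) * (inv (suc j ℕ.* suc k) * inv (suc k))
            ≡⟨ cong (b (suc k) * sgn (k ∸ j) * v′ (suc j) *_) (inv-* (k ℕ.+ j ℕ.* suc k) k) ⟨
          b (suc k) * sgn (k ∸ j) * v′ (suc j) * inv (suc j ℕ.* suc k ℕ.* suc k) ∎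
          where
          reorder : ∀ b σ x i iK → (b * (iK * iK)) * (σ * (x * i)) ≡ b * σ * x * ((i * iK) * iK)
          reorder = solve-∀ ℚ-ring

    lhs-rec : ∀ n → lhs3 (suc n) t ≡ ρ n * lhs3 n t + inv (suc n ℕ.* suc n ℕ.* suc n) * t ^ suc n
    lhs-rec n = lhs-step n (suc n ℕ.* suc n ℕ.* suc n) (t ^ suc n) _ (s≤s z≤n) refl

    rhs-rec : ∀ n → rhs3 (suc n) t ≡ ρ n * rhs3 n t + inv (suc n ℕ.* suc n ℕ.* suc n) * t ^ suc n
    rhs-rec n = begin
      rhs3 (suc n) t
        ≡⟨ rhs3-Σᴮ (suc n) ⟩
      Σᴮ (2 ℕ.* suc n) (suc n) (λ k → g k * inv (k ℕ.* k)) + c′ * H (suc n)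
        ≡⟨ cong₂ _+_ (Σᴮ-step-sq n g) (binom-central-*-Σ₁ n (λ k → inv (k ℕ.* k ℕ.* k))) ⟩
      (ρ n * S + q * Σᴮ (2 ℕ.* suc n) (suc n) g) + (ρ n * (c * H n) + c′ * inv (suc n ℕ.* suc n ℕ.* suc n))
        ≡⟨ cong₂ (λ x y → (ρ n * S + q * x) + (ρ n * (c * H n) + c′ * y))
                 (g-identity n) (inv-* (n ℕ.+ n ℕ.* suc n) n) ⟩
      (ρ n * S + q * (inv (suc n) * V)) + (ρ n * (c * H n) + c′ * (q * inv (suc n)))
        ≡⟨ regroup (ρ n) S q (inv (suc n)) V (c * H n) c′ ⟩
      ρ n * (S + c * H n) + (q * inv (suc n)) * (V + c′)
        ≡⟨ cong₂ (λ x y → ρ n * x + (q * inv (suc n)) * y) (sym (rhs3-Σᴮ n)) (even-row (suc n)) ⟩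
      ρ n * rhs3 n t + (q * inv (suc n)) * t ^ suc n
        ≡⟨ cong (λ x → ρ n * rhs3 n t + x * t ^ suc n) (inv-* (n ℕ.+ n ℕ.* suc n) n) ⟨
      ρ n * rhs3 n t + inv (suc n ℕ.* suc n ℕ.* suc n) * t ^ suc n ∎
      where
      S = Σᴮ (2 ℕ.* n) n (λ k → g k * inv (k ℕ.* k))
      V = Σᴮ (2 ℕ.* suc n) (suc n) v′
      q = inv (suc n ℕ.* suc n)
      c = binom (2 ℕ.* n) n
      c′ = binom (2 ℕ.* suc n) (suc n)
      regroup : ∀ r S q i V C c′ → (r * S + q * (i * V)) + (r * C + c′ * (q * i)) ≡ r * (S + C) + (q * i) * (V + c′)
      regroup = solve-∀ ℚ-ring

theorem5p2 : (n : ℕ) → 1 ≤ n → (t : ℚ) →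
    (lhs1 n t ≡ rhs1 n t) × (lhs2 n t ≡ rhs2 n t) × (lhs3 n t ≡ rhs3 n t)
theorem5p2 n _ t = identity₁ n , identity₂ n , identity₃ n
  where open Identities t
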